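{- Let $q$ be a positive integer and consider an instance of \textsc{Min-Lin-Eq}$(q)$-\textsc{Full} on the complete graph with $n$ vertices and $m=\binom n2$ edges. Let $\mathrm{OPT}_{val}$ be the minimum number of unsatisfied constraints over all assignments, let $\varepsilon=\mathrm{OPT}_{val}/m$, assume $\varepsilon<\frac12$, and let $\nu=2/(1-2\varepsilon)$. Then the Voting Algorithm (with any tie-breaking) returns an assignment with at most $(\varepsilon+2\varepsilon^2\nu(2+\nu)+o(1))\,m$ unsatisfied constraints, where the $o(1)$ term tends to $0$ as $n\to\infty$.
   Context: \textsc{Min-Lin-Eq}$(q)$-\textsc{Full}: given the complete simple graph $G=(V,E)$ on $n$ vertices, a positive integer $q$, and for each ordered pair of distinct vertices $(u,v)$ an integer $c_{uv}\in[q]=\{0,\dots,q-1\}$ with $c_{vu}=q-c_{uv}\bmod q$, each edge $uv$ carries the constraint $x_u-x_v\equiv c_{uv}\pmod q$. An assignment is a map $x:V\to[q]$; the goal is to minimize the number of unsatisfied constraints. Voting Algorithm: for each choice of pivot $p\in V$: (1) set $\mathrm{TEMP}(p)=0$ and $\mathrm{TEMP}(v)=c_{vp}$ for every $v\ne p$; (2) for each vertex $v$, every vertex $u\notin\{p,v\}$ votes for the label $(c_{vu}+\mathrm{TEMP}(u))\bmod q$ for $v$; (3) $v$ receives as final label $\mathrm{FINAL}(v)$ a label with the maximum number of votes (ties broken arbitrarily). (4) Output, among the $n$ resulting assignments (one per pivot), one with the fewest unsatisfied constraints. -}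

module Defs where

open import Data.Nat as ℕ using (ℕ; zero; suc; _∸_; NonZero)
open import Data.Nat.DivMod using (_%_)
open import Data.Fin as Fin using (Fin; toℕ)
open import Data.Fin.Properties using (all?)
open import Data.List using (List; map; length; filter)
open import Data.Nat.ListAction using (sum)
open import Data.Bool using (if_then_else_)
open import Data.Integer using (+_)
open import Data.Rational as ℚ using (ℚ; 0ℚ; 1ℚ; _/_; 1/_; ≢-nonZero)
open import Data.Rational.Properties using (_≟_)
open import Data.Product using (_×_)
open import Data.List using (allFin)
open import Relation.Binary.PropositionalEquality using (_≡_; _≢_)
open import Relation.Nullary using (¬_; yes; no; does)
open import Relation.Nullary.Decidable using (_×-dec_; ¬?)

-- An instance of Min-Lin-Eq(q)-Full on the complete graph with vertex set Fin n:
-- c u v is the constant c_{uv} ∈ [q] (diagonal values c u u are irrelevant).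
ValidInstance : (q n : ℕ) .{{_ : NonZero q}} → (Fin n → Fin n → Fin q) → Set
ValidInstance q n c = ∀ u v → u ≢ v → toℕ (c v u) ≡ (q ∸ toℕ (c u v)) % q

-- Constraint on edge uv:  x_u - x_v ≡ c_{uv} (mod q), i.e. (x_u + (q - x_v)) mod q = c_{uv}.
-- Number of unsatisfied constraints: count over unordered edges {u,v}, u < v.
cost : (q n : ℕ) .{{_ : NonZero q}} → (Fin n → Fin n → Fin q) → (Fin n → Fin q) → ℕ
cost q n c x =
  sum (map (λ u → length (filter (λ v → (u Fin.<? v) ×-dec ¬? (toℕ (c u v) ℕ.≟ (toℕ (x u) ℕ.+ (q ∸ toℕ (x v))) % q)) (allFin n))) (allFin n))

IsOpt : (q n : ℕ) .{{_ : NonZero q}} → (Fin n → Fin n → Fin q) → ℕ → Set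
IsOpt q n c o = (Data.Product.Σ (Fin n → Fin q) λ x → cost q n c x ≡ o) × (∀ x → o ℕ.≤ cost q n c x)

temp : (q n : ℕ) .{{_ : NonZero q}} → (Fin n → Fin n → Fin q) → Fin n → Fin n → ℕ
temp q n c p v with v Fin.≟ p
... | yes _ = 0
... | no _ = toℕ (c v p)

votes : (q n : ℕ) .{{_ : NonZero q}} → (Fin n → Fin n → Fin q) → Fin n → Fin n → Fin q → ℕ
votes q n c p v ℓ =
  length (filter (λ u → ¬? (u Fin.≟ p) ×-dec ¬? (u Fin.≟ v) ×-dec ((toℕ (c v u) ℕ.+ temp q n c p u) % q ℕ.≟ toℕ ℓ)) (allFin n))

-- Step (3), any tie-breaking: FINAL gives each v a label of maximum vote count.
IsVotingOutput : (q n : ℕ) .{{_ : NonZero q}} → (Fin n → Fin n → Fin q) → Fin n → (Fin n → Fin q) → Set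
IsVotingOutput q n c p final = ∀ v ℓ → votes q n c p v ℓ ℕ.≤ votes q n c p v (final v)

edgesℚ : ℕ → ℚ
edgesℚ n = + (n ℕ.* (n ∸ 1)) / 2

-- ε = OPT / m  (m = 0 only for n ≤ 1; then ε := 0, irrelevant)
epsilon : ℕ → ℕ → ℚ
epsilon o n with n ℕ.* (n ∸ 1)
... | zero = 0ℚ
... | suc k = + (2 ℕ.* o) / suc k

-- total multiplicative inverse (only used where the argument is nonzero)
inv : ℚ → ℚ
inv p with p ≟ 0ℚ
... | yes _ = 0ℚ
... | no p≢0 = 1/_ p {{≢-nonZero p≢0}}

nu : ℚ → ℚ
nu ε = (+ 2 / 1) ℚ.* inv (1ℚ ℚ.- (+ 2 / 1) ℚ.* ε)

-- Let x be an optimal assignment and p a vertex of least degree a in the graph of constraints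
-- violated by x, so that n·a ≤ 2·OPT, and relabel x so that p gets label 0.  For the pivot p, every
-- vertex u ∉ {p, v} with uv and up both satisfied by x votes for the relabelled value of v, so that
-- label receives at least n − deg v − a − 2 votes, whereas any other label receives at most deg v + a.
-- Hence a misvoted vertex (final label different from the relabelled one) has degree at least
-- (n − 2a − 2)/2, and there are K ≤ εν(n − 1) + 4 of them.  Edges between correctly voted vertices are
-- violated exactly as under x; the edges violated between a misvoted v and correctly voted vertices
-- are again charged to the votes at v, at most deg v + 2a + 2 of them; and at most K² edges join
-- misvoted vertices.  So the output violates at most OPT + K² + K(2a + 2) constraints, which is below
-- (ε + 2ε²ν(2 + ν) + δ)·m once n ≥ 9 + 84/δ.  For ε ≥ 1/4 the coefficient exceeds 1 and the bound
-- is trivial.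

module Submission where

open import Defs

module Counting where
  open import Data.Nat as ℕ using (ℕ; zero; suc; _+_; _*_; _≤_; z≤n; s≤s)
  open import Data.Nat.Properties
  open import Data.Fin as Fin using (Fin)
  import Data.Fin.Properties as Finₚ
  open import Data.Bool using (if_then_else_)
  open import Data.List using (length; filter; map; tabulate)
  open import Data.Nat.ListAction using () renaming (sum to sumᴸ)
  open import Data.Product using (_×_; _,_; proj₁; proj₂)
  open import Data.Empty using (⊥)
  open import Function using (_∘_; _⇔_; Equivalence)
  open import Level using (Level)
  open import Relation.Nullary using (Dec; yes; no; does; ¬_; contradiction)
  open import Relation.Nullary.Decidable using (_×-dec_; _⊎-dec_; ¬?)
  open import Relation.Unary using (Pred; Decidable; _⊆_; _∩_)
  open import Relation.Unary.Properties using (_∩?_; _∪?_; ∁?; ∅?)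
  open import Relation.Binary.PropositionalEquality
  open import Relation.Binary.Definitions using (tri<; tri≈; tri>)
  open import Data.Nat.Tactic.RingSolver using (solve-∀)
  open import Algebra.Properties.Semiring.Sum +-*-semiring
    using (sum; sum-syntax; sum-cong-≗; ∑-distrib-+; ∑-comm; *-distribʳ-sum)

  private variable
    ℓ : Level
    n : ℕ
    A B C : Set ℓ

  sum-const : ∀ n k → ∑[ i < n ] k ≡ n * k
  sum-const zero    k = refl
  sum-const (suc n) k = cong (k +_) (sum-const n k)

  sum-mono-≤ : {f g : Fin n → ℕ} → (∀ i → f i ≤ g i) → sum f ≤ sum g
  sum-mono-≤ {zero}  f≤g = z≤n
  sum-mono-≤ {suc n} f≤g = +-mono-≤ (f≤g Fin.zero) (sum-mono-≤ (λ i → f≤g (Fin.suc i)))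

  sumᴸ-map-tabulate : (f : A → ℕ) (g : Fin n → A) → sumᴸ (map f (tabulate g)) ≡ ∑[ i < n ] f (g i)
  sumᴸ-map-tabulate {n = zero}  f g = refl
  sumᴸ-map-tabulate {n = suc n} f g = cong (f (g Fin.zero) +_) (sumᴸ-map-tabulate f (λ i → g (Fin.suc i)))

  sum-zero : (f : Fin n → ℕ) → (∀ i → f i ≡ 0) → sum f ≡ 0
  sum-zero {zero}  f f≡0 = refl
  sum-zero {suc n} f f≡0 = cong₂ _+_ (f≡0 Fin.zero) (sum-zero (λ i → f (Fin.suc i)) (λ i → f≡0 (Fin.suc i)))

  𝟙 : Dec A → ℕ
  𝟙 a = if does a then 1 else 0

  𝟙-yes : (a : Dec A) → A → 𝟙 a ≡ 1
  𝟙-yes (yes _) _  = refl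
  𝟙-yes (no ¬a) a = contradiction a ¬a

  𝟙-no : (a : Dec A) → ¬ A → 𝟙 a ≡ 0
  𝟙-no (yes a) ¬a = contradiction a ¬a
  𝟙-no (no _)  _  = refl

  𝟙≤1 : (a : Dec A) → 𝟙 a ≤ 1
  𝟙≤1 (yes _) = ≤-refl
  𝟙≤1 (no _)  = z≤n

  𝟙-mono : (a : Dec A) (b : Dec B) → (A → B) → 𝟙 a ≤ 𝟙 b
  𝟙-mono (yes a) b A→B = ≤-reflexive (sym (𝟙-yes b (A→B a)))
  𝟙-mono (no _)  b A→B = z≤n

  𝟙-cong : (a : Dec A) (b : Dec B) → (A → B) → (B → A) → 𝟙 a ≡ 𝟙 b
  𝟙-cong a b A→B B→A = ≤-antisym (𝟙-mono a b A→B) (𝟙-mono b a B→A)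

  𝟙-⊎ : (a : Dec A) (b : Dec B) → 𝟙 (a ⊎-dec b) ≤ 𝟙 a + 𝟙 b
  𝟙-⊎ (yes _) b = s≤s z≤n
  𝟙-⊎ (no _)  b = ≤-refl

  𝟙-overlap : (a : Dec A) (b : Dec B) (c : Dec C) → (A → B → C) → 𝟙 a + 𝟙 b ≤ 1 + 𝟙 c
  𝟙-overlap (yes a) (yes b) c f = ≤-reflexive (cong suc (sym (𝟙-yes c (f a b))))
  𝟙-overlap (yes _) (no _)  c f = s≤s z≤n
  𝟙-overlap (no _)  b       c f = ≤-trans (𝟙≤1 b) (m≤m+n 1 (𝟙 c))

  𝟙-split : (w : Dec A) (b : Dec B) → 𝟙 b ≡ 𝟙 (w ×-dec b) + 𝟙 (¬? w ×-dec b)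
  𝟙-split (yes _) b = sym (+-identityʳ (𝟙 b))
  𝟙-split (no _)  b = refl

  𝟙-partition : (a : Dec A) (x : ℕ) → x ≡ 𝟙 a * x + 𝟙 (¬? a) * x
  𝟙-partition (yes _) x = sym (trans (+-identityʳ (1 * x)) (*-identityˡ x))
  𝟙-partition (no _)  x = sym (+-identityʳ x)

  count : {P : Pred (Fin n) ℓ} → Decidable P → ℕ
  count {n} P? = ∑[ i < n ] 𝟙 (P? i)

  module _ {P : Pred (Fin n) ℓ} {Q : Pred (Fin n) ℓ} (P? : Decidable P) (Q? : Decidable Q) where

    count-mono : P ⊆ Q → count P? ≤ count Q?
    count-mono P⊆Q = sum-mono-≤ (λ i → 𝟙-mono (P? i) (Q? i) P⊆Q)

    count-∪ : count (P? ∪? Q?) ≤ count P? + count Q?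
    count-∪ = ≤-trans (sum-mono-≤ (λ i → 𝟙-⊎ (P? i) (Q? i)))
                      (≤-reflexive (∑-distrib-+ (λ i → 𝟙 (P? i)) (λ i → 𝟙 (Q? i))))

    count-split : count Q? ≡ count (P? ∩? Q?) + count (∁? P? ∩? Q?)
    count-split = trans (sum-cong-≗ (λ i → 𝟙-split (P? i) (Q? i)))
                        (∑-distrib-+ (λ i → 𝟙 ((P? ∩? Q?) i)) (λ i → 𝟙 ((∁? P? ∩? Q?) i)))

    count-overlap : ∀ {ℓ′} {R : Pred (Fin n) ℓ′} (R? : Decidable R) →
                    P ∩ Q ⊆ R → count P? + count Q? ≤ n + count R?
    count-overlap R? PQ⊆R = begin
      count P? + count Q?
        ≡⟨ ∑-distrib-+ (λ i → 𝟙 (P? i)) (λ i → 𝟙 (Q? i)) ⟨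
      ∑[ i < n ] (𝟙 (P? i) + 𝟙 (Q? i))
        ≤⟨ sum-mono-≤ (λ i → 𝟙-overlap (P? i) (Q? i) (R? i) (λ p q → PQ⊆R (p , q))) ⟩
      ∑[ i < n ] (1 + 𝟙 (R? i))
        ≡⟨ ∑-distrib-+ (λ _ → 1) (λ i → 𝟙 (R? i)) ⟩
      ∑[ i < n ] 1 + count R?
        ≡⟨ cong (_+ count R?) (trans (sum-const n 1) (*-identityʳ n)) ⟩
      n + count R? ∎
      where open ≤-Reasoning

  count-disjoint : {P Q : Pred (Fin n) ℓ} (P? : Decidable P) (Q? : Decidable Q) →
                   (∀ {i} → P i → Q i → ⊥) → count P? + count Q? ≤ n
  count-disjoint {n} P? Q? disjoint = begin
    count P? + count Q?   ≤⟨ count-overlap P? Q? (∅? {A = Fin n}) (λ (p , q) → disjoint p q) ⟩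
    n + count (∅? {A = Fin n}) ≡⟨ cong (n +_) (sum-zero {n} (λ _ → 0) (λ _ → refl)) ⟩
    n + 0                 ≡⟨ +-identityʳ n ⟩
    n                     ∎
    where open ≤-Reasoning

  count-universal : {P : Pred (Fin n) ℓ} (P? : Decidable P) → (∀ i → P i) → count P? ≡ n
  count-universal {n} P? all = begin
    count P?       ≡⟨ sum-cong-≗ (λ i → 𝟙-yes (P? i) (all i)) ⟩
    ∑[ i < n ] 1   ≡⟨ sum-const n 1 ⟩
    n * 1          ≡⟨ *-identityʳ n ⟩
    n              ∎
    where open ≡-Reasoning

  count-≟ : (v : Fin n) → count (Fin._≟ v) ≡ 1
  count-≟ {suc n} Fin.zero    =
    cong suc (sum-zero {n} (λ i → 𝟙 (Fin.suc i Fin.≟ Fin.zero)) λ i → 𝟙-no (Fin.suc i Fin.≟ Fin.zero) λ ())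
  count-≟ {suc n} (Fin.suc v) = trans
    (sum-cong-≗ λ i → 𝟙-cong (Fin.suc i Fin.≟ Fin.suc v) (i Fin.≟ v) Finₚ.suc-injective (cong Fin.suc))
    (count-≟ v)

  sum-𝟙-×-dec : {P : Pred (Fin n) ℓ} (a : Dec A) (P? : Decidable P) →
                ∑[ i < n ] 𝟙 (a ×-dec P? i) ≡ 𝟙 a * count P?
  sum-𝟙-×-dec {n} (yes _) P? = sym (+-identityʳ (count P?))
  sum-𝟙-×-dec {n} (no _)  P? = sum-zero {n} (λ _ → 0) λ _ → refl

  length-filter-tabulate : {P : Pred A ℓ} (P? : Decidable P) (g : Fin n → A) →
                           length (filter P? (tabulate g)) ≡ ∑[ i < n ] 𝟙 (P? (g i))
  length-filter-tabulate {n = zero}  P? g = refl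
  length-filter-tabulate {n = suc n} P? g with P? (g Fin.zero)
  ... | yes _ = cong suc (length-filter-tabulate P? (λ i → g (Fin.suc i)))
  ... | no _  = length-filter-tabulate P? (λ i → g (Fin.suc i))

  𝟙-*-mono : (a : Dec A) {x y : ℕ} → (A → x ≤ y) → 𝟙 a * x ≤ 𝟙 a * y
  𝟙-*-mono (yes a) x≤y = *-monoʳ-≤ 1 (x≤y a)
  𝟙-*-mono (no _)  x≤y = z≤n

  module _ {R : Fin n → Pred (Fin n) ℓ} (R? : ∀ v → Decidable (R v)) where

    pairs : {A B : Pred (Fin n) ℓ} → Decidable A → Decidable B → ℕ
    pairs A? B? = ∑[ v < n ] ∑[ u < n ] 𝟙 (A? v ×-dec (B? u ×-dec R? v u))

    module _ {A B : Pred (Fin n) ℓ} (A? : Decidable A) (B? : Decidable B) where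

      pairs-rows : pairs A? B? ≡ ∑[ v < n ] (𝟙 (A? v) * count (B? ∩? R? v))
      pairs-rows = sum-cong-≗ λ v → sum-𝟙-×-dec (A? v) (B? ∩? R? v)

      pairs-≤-rows : (g : Fin n → ℕ) → (∀ v → A v → count (B? ∩? R? v) ≤ g v) →
                     pairs A? B? ≤ ∑[ v < n ] (𝟙 (A? v) * g v)
      pairs-≤-rows g bound = ≤-trans (≤-reflexive pairs-rows) (sum-mono-≤ λ v → 𝟙-*-mono (A? v) (bound v))

      pairs-≤-* : pairs A? B? ≤ count A? * count B?
      pairs-≤-* = begin
        pairs A? B?                        ≤⟨ pairs-≤-rows (λ _ → count B?) (λ v _ → count-mono (B? ∩? R? v) B? proj₁) ⟩
        ∑[ v < n ] (𝟙 (A? v) * count B?)   ≡⟨ *-distribʳ-sum (count B?) (λ v → 𝟙 (A? v)) ⟨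
        count A? * count B?                ∎
        where open ≤-Reasoning

    pairs-split-right : {A W : Pred (Fin n) ℓ} (A? : Decidable A) (W? : Decidable W) →
                        ∑[ v < n ] (𝟙 (A? v) * count (R? v)) ≡ pairs A? W? + pairs A? (∁? W?)
    pairs-split-right A? W? = begin
      ∑[ v < n ] (𝟙 (A? v) * count (R? v))
        ≡⟨ sum-cong-≗ (λ v → cong (𝟙 (A? v) *_) (count-split W? (R? v))) ⟩
      ∑[ v < n ] (𝟙 (A? v) * (count (W? ∩? R? v) + count (∁? W? ∩? R? v)))
        ≡⟨ sum-cong-≗ (λ v → *-distribˡ-+ (𝟙 (A? v)) _ _) ⟩
      ∑[ v < n ] (𝟙 (A? v) * count (W? ∩? R? v) + 𝟙 (A? v) * count (∁? W? ∩? R? v))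
        ≡⟨ ∑-distrib-+ (λ v → 𝟙 (A? v) * count (W? ∩? R? v)) (λ v → 𝟙 (A? v) * count (∁? W? ∩? R? v)) ⟩
      ∑[ v < n ] (𝟙 (A? v) * count (W? ∩? R? v)) + ∑[ v < n ] (𝟙 (A? v) * count (∁? W? ∩? R? v))
        ≡⟨ cong₂ _+_ (pairs-rows A? W?) (pairs-rows A? (∁? W?)) ⟨
      pairs A? W? + pairs A? (∁? W?) ∎
      where open ≡-Reasoning

    pairs-comm : (∀ {v u} → R v u → R u v) → {A B : Pred (Fin n) ℓ} (A? : Decidable A) (B? : Decidable B) →
                 pairs A? B? ≡ pairs B? A?
    pairs-comm R-sym A? B? = trans (∑-comm (λ v u → 𝟙 (A? v ×-dec (B? u ×-dec R? v u))))
      (sum-cong-≗ λ u → sum-cong-≗ λ v →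
        𝟙-cong (A? v ×-dec (B? u ×-dec R? v u)) (B? u ×-dec (A? v ×-dec R? u v))
               (λ (a , b , r) → b , a , R-sym r) (λ (b , a , r) → a , b , R-sym r))

    sum-count-split : (∀ {v u} → R v u → R u v) → {W : Pred (Fin n) ℓ} (W? : Decidable W) →
                      ∑[ v < n ] count (R? v) ≡ pairs W? W? + 2 * pairs W? (∁? W?) + pairs (∁? W?) (∁? W?)
    sum-count-split R-sym W? = begin
      ∑[ v < n ] count (R? v)
        ≡⟨ sum-cong-≗ (λ v → 𝟙-partition (W? v) (count (R? v))) ⟩
      ∑[ v < n ] (𝟙 (W? v) * count (R? v) + 𝟙 (∁? W? v) * count (R? v))
        ≡⟨ ∑-distrib-+ (λ v → 𝟙 (W? v) * count (R? v)) (λ v → 𝟙 (∁? W? v) * count (R? v)) ⟩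
      ∑[ v < n ] (𝟙 (W? v) * count (R? v)) + ∑[ v < n ] (𝟙 (∁? W? v) * count (R? v))
        ≡⟨ cong₂ _+_ (pairs-split-right W? W?) (pairs-split-right (∁? W?) W?) ⟩
      (pairs W? W? + pairs W? (∁? W?)) + (pairs (∁? W?) W? + pairs (∁? W?) (∁? W?))
        ≡⟨ cong (λ t → (pairs W? W? + pairs W? (∁? W?)) + (t + pairs (∁? W?) (∁? W?)))
                (pairs-comm R-sym (∁? W?) W?) ⟩
      (pairs W? W? + pairs W? (∁? W?)) + (pairs W? (∁? W?) + pairs (∁? W?) (∁? W?))
        ≡⟨ regroup (pairs W? W?) (pairs W? (∁? W?)) (pairs (∁? W?) (∁? W?)) ⟩
      pairs W? W? + 2 * pairs W? (∁? W?) + pairs (∁? W?) (∁? W?) ∎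
      where
      open ≡-Reasoning
      regroup : ∀ a b c → (a + b) + (b + c) ≡ a + 2 * b + c
      regroup = solve-∀

    private
      ordered-split : (∀ {v u} → R v u → R u v) → (∀ {v} → ¬ R v v) → ∀ v u →
                      𝟙 (R? v u) ≡ 𝟙 ((v Fin.<? u) ×-dec R? v u) + 𝟙 ((u Fin.<? v) ×-dec R? u v)
      ordered-split R-sym R-irr v u with Finₚ.<-cmp v u
      ... | tri< v<u _ u≮v = trans (𝟙-cong (R? v u) ((v Fin.<? u) ×-dec R? v u) (v<u ,_) proj₂)
        (sym (trans (cong (𝟙 ((v Fin.<? u) ×-dec R? v u) +_) (𝟙-no ((u Fin.<? v) ×-dec R? u v) (u≮v ∘ proj₁)))
                    (+-identityʳ _)))
      ... | tri> v≮u _ u<v = trans (𝟙-cong (R? v u) ((u Fin.<? v) ×-dec R? u v) (λ r → u<v , R-sym r) (R-sym ∘ proj₂))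
        (sym (cong (_+ 𝟙 ((u Fin.<? v) ×-dec R? u v)) (𝟙-no ((v Fin.<? u) ×-dec R? v u) (v≮u ∘ proj₁))))
      ... | tri≈ v≮u refl _ = trans (𝟙-no (R? v u) R-irr)
                                    (sym (cong₂ _+_ (𝟙-no ((v Fin.<? u) ×-dec R? v u) (v≮u ∘ proj₁))
                                                    (𝟙-no ((u Fin.<? v) ×-dec R? u v) (v≮u ∘ proj₁))))

    sum-count-symmetric : (∀ {v u} → R v u → R u v) → (∀ {v} → ¬ R v v) →
                          ∑[ v < n ] count (R? v) ≡ 2 * ∑[ v < n ] count ((v Fin.<?_) ∩? R? v)
    sum-count-symmetric R-sym R-irr = begin
      ∑[ v < n ] count (R? v)
        ≡⟨ sum-cong-≗ (λ v → trans (sum-cong-≗ (ordered-split R-sym R-irr v))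
                                   (∑-distrib-+ (upper v) (λ u → upper u v))) ⟩
      ∑[ v < n ] (∑[ u < n ] upper v u + ∑[ u < n ] upper u v)
        ≡⟨ ∑-distrib-+ (λ v → ∑[ u < n ] upper v u) (λ v → ∑[ u < n ] upper u v) ⟩
      X + ∑[ v < n ] ∑[ u < n ] upper u v
        ≡⟨ cong (X +_) (∑-comm (λ v u → upper u v)) ⟩
      X + X
        ≡⟨ cong (X +_) (+-identityʳ X) ⟨
      2 * X ∎
      where
      open ≡-Reasoning
      upper : Fin n → Fin n → ℕ
      upper v u = 𝟙 ((v Fin.<? u) ×-dec R? v u)
      X = ∑[ v < n ] count ((v Fin.<?_) ∩? R? v)

  pairs-cong : {R R′ : Fin n → Pred (Fin n) ℓ} (R? : ∀ v → Decidable (R v)) (R′? : ∀ v → Decidable (R′ v))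
               {A B : Pred (Fin n) ℓ} (A? : Decidable A) (B? : Decidable B) →
               (∀ {v u} → A v → B u → R v u ⇔ R′ v u) → pairs R? A? B? ≡ pairs R′? A? B?
  pairs-cong R? R′? A? B? R⇔R′ = sum-cong-≗ λ v → sum-cong-≗ λ u →
    𝟙-cong (A? v ×-dec (B? u ×-dec R? v u)) (A? v ×-dec (B? u ×-dec R′? v u))
      (λ (a , b , r) → a , b , Equivalence.to (R⇔R′ a b) r)
      (λ (a , b , r′) → a , b , Equivalence.from (R⇔R′ a b) r′)

module VotingAlgorithm where
  open import Data.Nat as ℕ using (ℕ; suc; _+_; _*_; _∸_; _≤_; _<_; z≤n; NonZero)
  open import Data.Nat.Properties
  open import Data.Nat.Tactic.RingSolver using (solve-∀)
  open import Data.Nat.DivMod using (_%_; m%n%n≡m%n; m%n<n; m<n⇒m%n≡m; [m+n]%n≡m%n; %-distribˡ-+)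
  open import Data.Fin as Fin using (Fin; toℕ)
  open import Data.List using (length; filter; allFin)
  open import Data.List.Extrema.Nat using (argmin; f[argmin]≤f[xs])
  import Data.List.Relation.Unary.All as All
  open import Data.List.Membership.Propositional.Properties using (∈-allFin)
  open import Function using (id; _∘_; _⇔_; mk⇔; Equivalence)
  open import Relation.Unary using (∁; _∩_; Decidable)
  open import Relation.Unary.Properties using (_∩?_; _∪?_; ∁?)
  import Data.Fin.Properties as Finₚ
  open import Data.Product using (Σ; _×_; _,_)
  open import Data.Sum using (_⊎_; inj₁; inj₂)
  open import Level using (0ℓ)
  open import Relation.Nullary using (Dec; yes; no; ¬_; contradiction)
  open import Relation.Nullary.Decidable using (_×-dec_; ¬?; decidable-stable)
  open import Relation.Binary using (Setoid)
  open import Relation.Binary.PropositionalEquality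
  import Relation.Binary.Reasoning.Setoid as SetoidReasoning
  open import Algebra.Properties.Semiring.Sum +-*-semiring
    using (sum; sum-syntax; sum-cong-≗; ∑-distrib-+; *-distribˡ-sum; *-distribʳ-sum)
  open Counting

  module Modular (q : ℕ) .{{_ : NonZero q}} where

    infix 4 _≈_
    -- A record rather than a function of a and b, so that a and b can be inferred from a proof.
    record _≈_ (a b : ℕ) : Set where
      constructor mod
      field %-≡ : a % q ≡ b % q
    open _≈_

    ≈-setoid : Setoid 0ℓ 0ℓ
    ≈-setoid = record
      { Carrier       = ℕ
      ; _≈_           = _≈_
      ; isEquivalence = record
        { refl  = mod refl
        ; sym   = λ a≈b → mod (sym (%-≡ a≈b))
        ; trans = λ a≈b b≈c → mod (trans (%-≡ a≈b) (%-≡ b≈c))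
        }
      }
    open Setoid ≈-setoid public using () renaming (refl to ≈-refl; sym to ≈-sym; trans to ≈-trans)

    +-cong : ∀ {a b c d} → a ≈ b → c ≈ d → a + c ≈ b + d
    +-cong {a} {b} {c} {d} (mod a≈b) (mod c≈d) = mod (begin
      (a + c) % q             ≡⟨ %-distribˡ-+ a c q ⟩
      (a % q + c % q) % q     ≡⟨ cong₂ (λ s t → (s + t) % q) a≈b c≈d ⟩
      (b % q + d % q) % q     ≡⟨ %-distribˡ-+ b d q ⟨
      (b + d) % q             ∎)
      where open ≡-Reasoning

    +-congˡ : ∀ a {c d} → c ≈ d → a + c ≈ a + d
    +-congˡ a = +-cong (≈-refl {a})

    +-congʳ : ∀ c {a b} → a ≈ b → a + c ≈ b + c
    +-congʳ c a≈b = +-cong a≈b (≈-refl {c})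

    %-≈ : ∀ a → a % q ≈ a
    %-≈ a = mod (m%n%n≡m%n a q)

    q≈0 : q ≈ 0
    q≈0 = mod ([m+n]%n≡m%n 0 q)

    ≈⇒≡ : ∀ {a b} → a < q → b < q → a ≈ b → a ≡ b
    ≈⇒≡ a<q b<q (mod a≈b) = trans (sym (m<n⇒m%n≡m a<q)) (trans a≈b (m<n⇒m%n≡m b<q))

    ∸+-≈ : ∀ {b} → b ≤ q → (q ∸ b) + b ≈ 0
    ∸+-≈ b≤q = ≈-trans (mod (cong (_% q) (m∸n+n≡m b≤q))) q≈0

    ∸-≈ : ∀ a {b} → b ≤ q → (a + (q ∸ b)) % q + b ≈ a
    ∸-≈ a {b} b≤q = begin
      (a + (q ∸ b)) % q + b  ≈⟨ +-congʳ b (%-≈ (a + (q ∸ b))) ⟩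
      a + (q ∸ b) + b        ≡⟨ +-assoc a (q ∸ b) b ⟩
      a + ((q ∸ b) + b)      ≈⟨ +-congˡ a (∸+-≈ b≤q) ⟩
      a + 0                  ≡⟨ +-identityʳ a ⟩
      a                      ∎
      where open SetoidReasoning ≈-setoid

    +-inverse-≈ : ∀ c → c + (q ∸ c % q) ≈ 0
    +-inverse-≈ c = begin
      c + (q ∸ c % q)        ≡⟨ +-comm c (q ∸ c % q) ⟩
      (q ∸ c % q) + c        ≈⟨ +-congˡ (q ∸ c % q) (%-≈ c) ⟨
      (q ∸ c % q) + c % q    ≈⟨ ∸+-≈ (<⇒≤ (m%n<n c q)) ⟩
      0                      ∎
      where open SetoidReasoning ≈-setoid

    +-cancelʳ-≈ : ∀ {a b} c → a + c ≈ b + c → a ≈ b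
    +-cancelʳ-≈ {a} {b} c a+c≈b+c = begin
      a                      ≡⟨ +-identityʳ a ⟨
      a + 0                  ≈⟨ +-congˡ a (+-inverse-≈ c) ⟨
      a + (c + r)            ≡⟨ +-assoc a c r ⟨
      a + c + r              ≈⟨ +-congʳ r a+c≈b+c ⟩
      b + c + r              ≡⟨ +-assoc b c r ⟩
      b + (c + r)            ≈⟨ +-congˡ b (+-inverse-≈ c) ⟩
      b + 0                  ≡⟨ +-identityʳ b ⟩
      b                      ∎
      where
      open SetoidReasoning ≈-setoid
      r = q ∸ c % q

  module Instance (q n : ℕ) .{{_ : NonZero q}} (c : Fin n → Fin n → Fin q) (valid : ValidInstance q n c) where
    open Modular q

    Assignment : Set
    Assignment = Fin n → Fin q

    Sat : Assignment → Fin n → Fin n → Set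
    Sat w u v = toℕ (c u v) ≡ (toℕ (w u) + (q ∸ toℕ (w v))) % q

    Sat? : ∀ w u v → Dec (Sat w u v)
    Sat? w u v = toℕ (c u v) ℕ.≟ (toℕ (w u) + (q ∸ toℕ (w v))) % q

    Sat⇒≈ : ∀ {w u v} → Sat w u v → toℕ (c u v) + toℕ (w v) ≈ toℕ (w u)
    Sat⇒≈ {w} {u} {v} sat = ≈-trans (mod (cong (λ t → (t + toℕ (w v)) % q) sat))
                                    (∸-≈ (toℕ (w u)) (Finₚ.toℕ≤n (w v)))

    ≈⇒Sat : ∀ {w u v} → toℕ (c u v) + toℕ (w v) ≈ toℕ (w u) → Sat w u v
    ≈⇒Sat {w} {u} {v} cw≈w = ≈⇒≡ (Finₚ.toℕ<n (c u v)) (m%n<n _ q)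
      (+-cancelʳ-≈ (toℕ (w v)) (≈-trans cw≈w (≈-sym (∸-≈ (toℕ (w u)) (Finₚ.toℕ≤n (w v))))))

    c-antisym : ∀ {u v} → u ≢ v → toℕ (c v u) + toℕ (c u v) ≈ 0
    c-antisym {u} {v} u≢v = ≈-trans (mod (cong (λ t → (t + toℕ (c u v)) % q) (valid u v u≢v)))
                                    (∸-≈ 0 (Finₚ.toℕ≤n (c u v)))

    Sat-sym : ∀ {w u v} → u ≢ v → Sat w u v → Sat w v u
    Sat-sym {w} {u} {v} u≢v sat = ≈⇒Sat (begin
      toℕ (c v u) + toℕ (w u)                   ≈⟨ +-congˡ (toℕ (c v u)) (Sat⇒≈ sat) ⟨
      toℕ (c v u) + (toℕ (c u v) + toℕ (w v))   ≡⟨ +-assoc (toℕ (c v u)) (toℕ (c u v)) (toℕ (w v)) ⟨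
      toℕ (c v u) + toℕ (c u v) + toℕ (w v)     ≈⟨ +-congʳ (toℕ (w v)) (c-antisym u≢v) ⟩
      toℕ (w v)                                 ∎)
      where open SetoidReasoning ≈-setoid

    Violated : Assignment → Fin n → Fin n → Set
    Violated w v u = u ≢ v × ¬ Sat w v u

    Violated? : ∀ w v u → Dec (Violated w v u)
    Violated? w v u = ¬? (u Fin.≟ v) ×-dec ¬? (Sat? w v u)

    Violated-sym : ∀ {w v u} → Violated w v u → Violated w u v
    Violated-sym {w} (u≢v , ¬sat) = ≢-sym u≢v , (λ sat → ¬sat (Sat-sym {w} u≢v sat))

    deg : Assignment → Fin n → ℕ
    deg w v = count (Violated? w v)

    cost≡sum-count : ∀ w → cost q n c w ≡ ∑[ u < n ] count ((u Fin.<?_) ∩? ∁? (Sat? w u))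
    cost≡sum-count w = trans (sumᴸ-map-tabulate (λ u → length (filter ((u Fin.<?_) ∩? ∁? (Sat? w u)) (allFin n))) id)
                             (sum-cong-≗ λ u → length-filter-tabulate ((u Fin.<?_) ∩? ∁? (Sat? w u)) id)

    handshake : ∀ w → ∑[ v < n ] deg w v ≡ 2 * cost q n c w
    handshake w = begin
      ∑[ v < n ] deg w v
        ≡⟨ sum-count-symmetric (Violated? w) (Violated-sym {w}) (λ (v≢v , _) → v≢v refl) ⟩
      2 * ∑[ v < n ] count ((v Fin.<?_) ∩? Violated? w v)
        ≡⟨ cong (2 *_) (sum-cong-≗ λ v → sum-cong-≗ λ u →
             𝟙-cong ((v Fin.<? u) ×-dec Violated? w v u) ((v Fin.<? u) ×-dec ¬? (Sat? w v u))
                    (λ (v<u , _ , ¬sat) → v<u , ¬sat)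
                    (λ (v<u , ¬sat) → v<u , (λ u≡v → Finₚ.<-irrefl (sym u≡v) v<u) , ¬sat)) ⟩
      2 * ∑[ v < n ] count ((v Fin.<?_) ∩? ∁? (Sat? w v))
        ≡⟨ cong (2 *_) (cost≡sum-count w) ⟨
      2 * cost q n c w ∎
      where open ≡-Reasoning

    deg<n : ∀ w v → deg w v < n
    deg<n w v = begin
      suc (deg w v)                 ≡⟨ +-comm 1 (deg w v) ⟩
      deg w v + 1                   ≡⟨ cong (deg w v +_) (count-≟ v) ⟨
      deg w v + count (Fin._≟ v)    ≤⟨ count-disjoint (Violated? w v) (Fin._≟ v) (λ (u≢v , _) u≡v → u≢v u≡v) ⟩
      n                             ∎
      where open ≤-Reasoning

    Sat-shift : ∀ {w w′ v u} s → toℕ (w′ v) + s ≈ toℕ (w v) → toℕ (w′ u) + s ≈ toℕ (w u) →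
                Sat w′ v u ⇔ Sat w v u
    Sat-shift {w} {w′} {v} {u} s v≈ u≈ = mk⇔
      (λ sat′ → ≈⇒Sat {w} (begin
        toℕ (c v u) + toℕ (w u)          ≈⟨ +-congˡ (toℕ (c v u)) u≈ ⟨
        toℕ (c v u) + (toℕ (w′ u) + s)   ≡⟨ +-assoc (toℕ (c v u)) (toℕ (w′ u)) s ⟨
        toℕ (c v u) + toℕ (w′ u) + s     ≈⟨ +-congʳ s (Sat⇒≈ {w′} sat′) ⟩
        toℕ (w′ v) + s                   ≈⟨ v≈ ⟩
        toℕ (w v)                        ∎))
      (λ sat → ≈⇒Sat {w′} (+-cancelʳ-≈ s (begin
        toℕ (c v u) + toℕ (w′ u) + s     ≡⟨ +-assoc (toℕ (c v u)) (toℕ (w′ u)) s ⟩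
        toℕ (c v u) + (toℕ (w′ u) + s)   ≈⟨ +-congˡ (toℕ (c v u)) u≈ ⟩
        toℕ (c v u) + toℕ (w u)          ≈⟨ Sat⇒≈ {w} sat ⟩
        toℕ (w v)                        ≈⟨ v≈ ⟨
        toℕ (w′ v) + s                   ∎)))
      where open SetoidReasoning ≈-setoid

    module Pivot (x : Assignment) (p : Fin n) where

      -- The labelling that honest votes reconstruct: x shifted so that the pivot gets label 0.
      shifted : Assignment
      shifted v = Fin.fromℕ< (m%n<n (toℕ (x v) + (q ∸ toℕ (x p))) q)

      shifted-≈ : ∀ v → toℕ (shifted v) + toℕ (x p) ≈ toℕ (x v)
      shifted-≈ v = ≈-trans (mod (cong (λ t → (t + toℕ (x p)) % q) (Finₚ.toℕ-fromℕ< _)))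
                            (∸-≈ (toℕ (x v)) (Finₚ.toℕ≤n (x p)))

      vote : Fin n → Fin n → ℕ
      vote v u = (toℕ (c v u) + temp q n c p u) % q

      Voter : Fin n → Fin q → Fin n → Set
      Voter v ℓ u = u ≢ p × u ≢ v × vote v u ≡ toℕ ℓ

      Voter? : ∀ v ℓ u → Dec (Voter v ℓ u)
      Voter? v ℓ u = ¬? (u Fin.≟ p) ×-dec ¬? (u Fin.≟ v) ×-dec (vote v u ℕ.≟ toℕ ℓ)

      votes≡count : ∀ v ℓ → votes q n c p v ℓ ≡ count (Voter? v ℓ)
      votes≡count v ℓ = length-filter-tabulate (Voter? v ℓ) id

      vote-≈ : ∀ {v u} → u ≢ p → Sat x u p → vote v u + toℕ (x p) ≈ toℕ (c v u) + toℕ (x u)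
      vote-≈ {v} {u} u≢p sat = begin
        vote v u + toℕ (x p)                          ≈⟨ +-congʳ (toℕ (x p)) (%-≈ _) ⟩
        toℕ (c v u) + temp q n c p u + toℕ (x p)      ≡⟨ cong (λ t → toℕ (c v u) + t + toℕ (x p)) (temp-≢ u≢p) ⟩
        toℕ (c v u) + toℕ (c u p) + toℕ (x p)         ≡⟨ +-assoc (toℕ (c v u)) (toℕ (c u p)) (toℕ (x p)) ⟩
        toℕ (c v u) + (toℕ (c u p) + toℕ (x p))       ≈⟨ +-congˡ (toℕ (c v u)) (Sat⇒≈ {x} sat) ⟩
        toℕ (c v u) + toℕ (x u)                       ∎
        where
        open SetoidReasoning ≈-setoid
        temp-≢ : ∀ {u} → u ≢ p → temp q n c p u ≡ toℕ (c u p)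
        temp-≢ {u} u≢p with u Fin.≟ p
        ... | yes u≡p = contradiction u≡p u≢p
        ... | no _    = refl

      honest-vote : ∀ {v u} → u ≢ p → Sat x u p → Sat x v u → vote v u ≡ toℕ (shifted v)
      honest-vote {v} {u} u≢p sat-up sat-vu =
        ≈⇒≡ (m%n<n _ q) (Finₚ.toℕ<n (shifted v)) (+-cancelʳ-≈ (toℕ (x p)) (begin
        vote v u + toℕ (x p)            ≈⟨ vote-≈ u≢p sat-up ⟩
        toℕ (c v u) + toℕ (x u)         ≈⟨ Sat⇒≈ {x} sat-vu ⟩
        toℕ (x v)                       ≈⟨ shifted-≈ v ⟨
        toℕ (shifted v) + toℕ (x p)     ∎))
        where open SetoidReasoning ≈-setoid

      vote⇒Sat : ∀ {z v u} → u ≢ p → Sat x u p → z u ≡ shifted u → vote v u ≡ toℕ (z v) → Sat z v u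
      vote⇒Sat {z} {v} {u} u≢p sat zu≡ vote≡ = ≈⇒Sat {z} (+-cancelʳ-≈ (toℕ (x p)) (begin
        toℕ (c v u) + toℕ (z u) + toℕ (x p)        ≡⟨ +-assoc (toℕ (c v u)) (toℕ (z u)) (toℕ (x p)) ⟩
        toℕ (c v u) + (toℕ (z u) + toℕ (x p))      ≈⟨ +-congˡ (toℕ (c v u)) (subst (λ t → toℕ t + toℕ (x p) ≈ toℕ (x u))
                                                                                 (sym zu≡) (shifted-≈ u)) ⟩
        toℕ (c v u) + toℕ (x u)                    ≈⟨ vote-≈ u≢p sat ⟨
        vote v u + toℕ (x p)                       ≡⟨ cong (_+ toℕ (x p)) vote≡ ⟩
        toℕ (z v) + toℕ (x p)                      ∎))
        where open SetoidReasoning ≈-setoid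

      module Output (z : Assignment) (z-vote : IsVotingOutput q n c p z) where

        Misvoted : Fin n → Set
        Misvoted v = z v ≢ shifted v

        Misvoted? : ∀ v → Dec (Misvoted v)
        Misvoted? v = ¬? (z v Fin.≟ shifted v)

        K a : ℕ
        K = count Misvoted?
        a = deg x p

        honest-voters : ∀ v → n ≤ votes q n c p v (shifted v) + (deg x v + (a + 2))
        honest-voters v = begin
          n                                   ≡⟨ count-universal all? everyone ⟨
          count all?                          ≤⟨ count-∪ V? (B? ∪? Bp? ∪? E?) ⟩
          count V? + count (B? ∪? Bp? ∪? E?)  ≤⟨ +-monoʳ-≤ (count V?) (≤-trans (count-∪ B? (Bp? ∪? E?))
                                                   (+-monoʳ-≤ (deg x v) (≤-trans (count-∪ Bp? E?) (+-monoʳ-≤ a (count-∪ (Fin._≟ p) (Fin._≟ v)))))) ⟩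
          count V? + (deg x v + (a + (count (Fin._≟ p) + count (Fin._≟ v))))
                                              ≡⟨ cong₂ (λ s t → s + (deg x v + (a + t))) (sym (votes≡count v (shifted v)))
                                                       (cong₂ _+_ (count-≟ p) (count-≟ v)) ⟩
          votes q n c p v (shifted v) + (deg x v + (a + 2)) ∎
          where
          open ≤-Reasoning
          V? = Voter? v (shifted v)
          B? = Violated? x v
          Bp? = Violated? x p
          E? = (Fin._≟ p) ∪? (Fin._≟ v)
          all? = V? ∪? B? ∪? Bp? ∪? E?
          everyone : ∀ u → Voter v (shifted v) u ⊎ Violated x v u ⊎ Violated x p u ⊎ u ≡ p ⊎ u ≡ v
          -- A helper rather than a with on u ≟ p, which would also abstract the u ≟ p inside temp.
          everyone u = classify (u Fin.≟ p) (u Fin.≟ v) (Sat? x v u) (Sat? x p u)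
            where
            classify : Dec (u ≡ p) → Dec (u ≡ v) → Dec (Sat x v u) → Dec (Sat x p u) →
                       Voter v (shifted v) u ⊎ Violated x v u ⊎ Violated x p u ⊎ u ≡ p ⊎ u ≡ v
            classify (yes u≡p) _         _         _          = inj₂ (inj₂ (inj₂ (inj₁ u≡p)))
            classify (no _)    (yes u≡v) _         _          = inj₂ (inj₂ (inj₂ (inj₂ u≡v)))
            classify (no _)    (no u≢v)  (no ¬sat) _          = inj₂ (inj₁ (u≢v , ¬sat))
            classify (no u≢p)  (no _)    (yes _)   (no ¬sat)  = inj₂ (inj₂ (inj₁ (u≢p , ¬sat)))
            classify (no u≢p)  (no u≢v)  (yes sat) (yes sat′) =
              inj₁ (u≢p , u≢v , honest-vote u≢p (Sat-sym {x} (≢-sym u≢p) sat′) sat)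

        votes-for-misvoted : ∀ {v} → Misvoted v → votes q n c p v (z v) ≤ deg x v + a
        votes-for-misvoted {v} misvoted = begin
          votes q n c p v (z v)                 ≡⟨ votes≡count v (z v) ⟩
          count (Voter? v (z v))                ≤⟨ count-mono (Voter? v (z v)) (Violated? x v ∪? Violated? x p) dishonest ⟩
          count (Violated? x v ∪? Violated? x p) ≤⟨ count-∪ (Violated? x v) (Violated? x p) ⟩
          deg x v + a                           ∎
          where
          open ≤-Reasoning
          dishonest : ∀ {u} → Voter v (z v) u → Violated x v u ⊎ Violated x p u
          dishonest {u} (u≢p , u≢v , vote≡) with Sat? x v u | Sat? x p u
          ... | no ¬sat | _         = inj₁ (u≢v , ¬sat)
          ... | yes _   | no ¬sat   = inj₂ (u≢p , ¬sat)
          ... | yes sat | yes sat′  = contradiction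
            (Finₚ.toℕ-injective (trans (sym vote≡) (honest-vote u≢p (Sat-sym {x} (≢-sym u≢p) sat′) sat)))
            misvoted

        misvoted⇒high-deg : ∀ {v} → Misvoted v → n ≤ 2 * deg x v + (2 * a + 2)
        misvoted⇒high-deg {v} misvoted = begin
          n                                                   ≤⟨ honest-voters v ⟩
          votes q n c p v (shifted v) + (deg x v + (a + 2))   ≤⟨ +-monoˡ-≤ _ (z-vote v (shifted v)) ⟩
          votes q n c p v (z v) + (deg x v + (a + 2))         ≤⟨ +-monoˡ-≤ _ (votes-for-misvoted misvoted) ⟩
          deg x v + a + (deg x v + (a + 2))                   ≡⟨ regroup (deg x v) a ⟩
          2 * deg x v + (2 * a + 2)                           ∎
          where
          open ≤-Reasoning
          regroup : ∀ d a → d + a + (d + (a + 2)) ≡ 2 * d + (2 * a + 2)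
          regroup = solve-∀

        clean⇒≡ : ∀ {v} → ¬ Misvoted v → z v ≡ shifted v
        clean⇒≡ {v} = decidable-stable (z v Fin.≟ shifted v)

        clean-violations : ∀ v → count (∁? Misvoted? ∩? Violated? z v) ≤ deg x v + (2 * a + 2)
        clean-violations v = +-cancelʳ-≤ (votes q n c p v (z v)) _ _ (begin
          count (∁? Misvoted? ∩? Violated? z v) + votes q n c p v (z v)
            ≡⟨ cong (count (∁? Misvoted? ∩? Violated? z v) +_) (votes≡count v (z v)) ⟩
          count (∁? Misvoted? ∩? Violated? z v) + count (Voter? v (z v))
            ≤⟨ count-overlap (∁? Misvoted? ∩? Violated? z v) (Voter? v (z v)) (Violated? x p) reveals-violation ⟩
          n + a
            ≤⟨ +-monoˡ-≤ a (honest-voters v) ⟩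
          votes q n c p v (shifted v) + (deg x v + (a + 2)) + a
            ≤⟨ +-monoˡ-≤ a (+-monoˡ-≤ _ (z-vote v (shifted v))) ⟩
          votes q n c p v (z v) + (deg x v + (a + 2)) + a
            ≡⟨ regroup (votes q n c p v (z v)) (deg x v) a ⟩
          deg x v + (2 * a + 2) + votes q n c p v (z v) ∎)
          where
          open ≤-Reasoning
          regroup : ∀ V d a → V + (d + (a + 2)) + a ≡ d + (2 * a + 2) + V
          regroup = solve-∀
          reveals-violation : ∀ {u} → ((∁ Misvoted ∩ Violated z v) ∩ Voter v (z v)) u → Violated x p u
          reveals-violation {u} ((clean , u≢v , ¬sat) , u≢p , _ , vote≡) =
            u≢p , (λ sat → ¬sat (vote⇒Sat {z} u≢p (Sat-sym {x} (≢-sym u≢p) sat) (clean⇒≡ clean) vote≡))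

        clean-Violated⇔ : ∀ {v u} → ¬ Misvoted v → ¬ Misvoted u → Violated z v u ⇔ Violated x v u
        clean-Violated⇔ {v} {u} clean-v clean-u = mk⇔
          (λ (u≢v , ¬sat) → u≢v , ¬sat ∘ Equivalence.from sat⇔)
          (λ (u≢v , ¬sat) → u≢v , ¬sat ∘ Equivalence.to sat⇔)
          where
          shifted-clean : ∀ {w} → ¬ Misvoted w → toℕ (z w) + toℕ (x p) ≈ toℕ (x w)
          shifted-clean {w} clean = subst (λ t → toℕ t + toℕ (x p) ≈ toℕ (x w)) (sym (clean⇒≡ clean)) (shifted-≈ w)
          sat⇔ : Sat z v u ⇔ Sat x v u
          sat⇔ = Sat-shift {x} {z} (toℕ (x p)) (shifted-clean clean-v) (shifted-clean clean-u)

        misvoted-count : K * n ≤ 2 * ∑[ v < n ] deg x v + K * (2 * a + 2)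
        misvoted-count = begin
          K * n
            ≡⟨ *-distribʳ-sum n (λ v → 𝟙 (Misvoted? v)) ⟩
          ∑[ v < n ] (𝟙 (Misvoted? v) * n)
            ≤⟨ sum-mono-≤ weighted ⟩
          ∑[ v < n ] (2 * deg x v + 𝟙 (Misvoted? v) * (2 * a + 2))
            ≡⟨ ∑-distrib-+ (λ v → 2 * deg x v) (λ v → 𝟙 (Misvoted? v) * (2 * a + 2)) ⟩
          ∑[ v < n ] (2 * deg x v) + ∑[ v < n ] (𝟙 (Misvoted? v) * (2 * a + 2))
            ≡⟨ cong₂ _+_ (*-distribˡ-sum 2 (deg x)) (*-distribʳ-sum (2 * a + 2) (λ v → 𝟙 (Misvoted? v))) ⟨
          2 * ∑[ v < n ] deg x v + K * (2 * a + 2) ∎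
          where
          open ≤-Reasoning
          weighted : ∀ v → 𝟙 (Misvoted? v) * n ≤ 2 * deg x v + 𝟙 (Misvoted? v) * (2 * a + 2)
          weighted v = weigh (Misvoted? v)
            where
            weigh : (m : Dec (Misvoted v)) → 𝟙 m * n ≤ 2 * deg x v + 𝟙 m * (2 * a + 2)
            weigh (yes misvoted) = subst₂ (λ s t → s ≤ 2 * deg x v + t)
                                          (sym (*-identityˡ n)) (sym (*-identityˡ (2 * a + 2)))
                                          (misvoted⇒high-deg misvoted)
            weigh (no _)         = z≤n

        -- Split the violations of z by misvoted (W) and correctly voted ends: inside W at most K²,
        -- across charged to the votes (row-bound), outside W the same as for x.
        cost-bound : cost q n c z ≤ cost q n c x + K * K + K * (2 * a + 2)
        cost-bound = *-cancelˡ-≤ 2 (begin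
          2 * cost q n c z
            ≡⟨ trans (sym (handshake z)) (sum-count-split (Violated? z) (Violated-sym {z}) W?) ⟩
          Z W? W? + 2 * Z W? W̄? + Z W̄? W̄?
            ≡⟨ cong (Z W? W? + 2 * Z W? W̄? +_) (pairs-cong (Violated? z) (Violated? x) W̄? W̄? clean-Violated⇔) ⟩
          Z W? W? + 2 * Z W? W̄? + X W̄? W̄?
            ≤⟨ +-monoˡ-≤ (X W̄? W̄?) (+-mono-≤ (pairs-≤-* (Violated? z) W? W?) (*-monoʳ-≤ 2 row-bound)) ⟩
          K * K + 2 * (X W? W? + X W? W̄? + K * (2 * a + 2)) + X W̄? W̄?
            ≡⟨ regroup (K * K) (K * (2 * a + 2)) (X W? W?) (X W? W̄?) (X W̄? W̄?) ⟩
          (X W? W? + 2 * X W? W̄? + X W̄? W̄?) + X W? W? + K * K + 2 * (K * (2 * a + 2))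
            ≡⟨ cong (λ t → t + X W? W? + K * K + 2 * (K * (2 * a + 2)))
                    (trans (sym (sum-count-split (Violated? x) (Violated-sym {x}) W?)) (handshake x)) ⟩
          2 * cost q n c x + X W? W? + K * K + 2 * (K * (2 * a + 2))
            ≤⟨ +-monoˡ-≤ (2 * (K * (2 * a + 2)))
                 (+-monoˡ-≤ (K * K) (+-monoʳ-≤ (2 * cost q n c x) (pairs-≤-* (Violated? x) W? W?))) ⟩
          2 * cost q n c x + K * K + K * K + 2 * (K * (2 * a + 2))
            ≡⟨ double (cost q n c x) (K * K) (K * (2 * a + 2)) ⟩
          2 * (cost q n c x + K * K + K * (2 * a + 2)) ∎)
          where
          open ≤-Reasoning
          W? = Misvoted?
          W̄? = ∁? Misvoted?
          Z X : ∀ {A B : Fin n → Set} → Decidable A → Decidable B → ℕ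
          Z = pairs (Violated? z)
          X = pairs (Violated? x)
          row-bound : Z W? W̄? ≤ X W? W? + X W? W̄? + K * (2 * a + 2)
          row-bound = begin
            Z W? W̄?
              ≤⟨ pairs-≤-rows (Violated? z) W? W̄? _ (λ v _ → clean-violations v) ⟩
            ∑[ v < n ] (𝟙 (W? v) * (deg x v + (2 * a + 2)))
              ≡⟨ sum-cong-≗ (λ v → *-distribˡ-+ (𝟙 (W? v)) (deg x v) (2 * a + 2)) ⟩
            ∑[ v < n ] (𝟙 (W? v) * deg x v + 𝟙 (W? v) * (2 * a + 2))
              ≡⟨ ∑-distrib-+ (λ v → 𝟙 (W? v) * deg x v) (λ v → 𝟙 (W? v) * (2 * a + 2)) ⟩
            ∑[ v < n ] (𝟙 (W? v) * deg x v) + ∑[ v < n ] (𝟙 (W? v) * (2 * a + 2))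
              ≡⟨ cong₂ _+_ (pairs-split-right (Violated? x) W? W?) (sym (*-distribʳ-sum (2 * a + 2) (λ v → 𝟙 (W? v)))) ⟩
            X W? W? + X W? W̄? + K * (2 * a + 2) ∎
          regroup : ∀ KK Kc XWW XWW̄ XW̄W̄ → KK + 2 * (XWW + XWW̄ + Kc) + XW̄W̄
                                          ≡ (XWW + 2 * XWW̄ + XW̄W̄) + XWW + KK + 2 * Kc
          regroup = solve-∀
          double : ∀ C KK Kc → 2 * C + KK + KK + 2 * Kc ≡ 2 * (C + KK + Kc)
          double = solve-∀

    2*cost≤n*pred[n] : ∀ w → 2 * cost q n c w ≤ n * ℕ.pred n
    2*cost≤n*pred[n] w = begin
      2 * cost q n c w         ≡⟨ handshake w ⟨
      ∑[ v < n ] deg w v       ≤⟨ sum-mono-≤ (λ v → <⇒≤pred (deg<n w v)) ⟩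
      ∑[ v < n ] ℕ.pred n      ≡⟨ sum-const n (ℕ.pred n) ⟩
      n * ℕ.pred n             ∎
      where open ≤-Reasoning

    best-output-bound : ∀ x {opt} → cost q n c x ≡ opt →
      (final : Fin n → Assignment) → (∀ p → IsVotingOutput q n c p (final p)) →
      (p* : Fin n) → (∀ p → cost q n c (final p*) ≤ cost q n c (final p)) →
      Σ ℕ λ K → Σ ℕ λ a → n * a ≤ 2 * opt × K * n ≤ 4 * opt + K * (2 * a + 2)
                          × cost q n c (final p*) ≤ opt + K * K + K * (2 * a + 2)
    best-output-bound x refl final voting p* p*-best =
      K , a , n*a≤ , ≤-trans misvoted-count (≤-reflexive (cong (_+ K * (2 * a + 2)) 2∑deg≡))
                   , ≤-trans (p*-best p) cost-bound
      where
      p = argmin (deg x) p* (allFin n)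
      open Pivot x p
      open Output (final p) (voting p)
      n*a≤ : n * a ≤ 2 * cost q n c x
      n*a≤ = begin
        n * a                  ≡⟨ sum-const n a ⟨
        ∑[ v < n ] a           ≤⟨ sum-mono-≤ (λ v → All.lookup (f[argmin]≤f[xs] p* (allFin n)) (∈-allFin v)) ⟩
        ∑[ v < n ] deg x v     ≡⟨ handshake x ⟩
        2 * cost q n c x       ∎
        where open ≤-Reasoning
      2∑deg≡ : 2 * ∑[ v < n ] deg x v ≡ 4 * cost q n c x
      2∑deg≡ = trans (cong (2 *_) (handshake x)) (sym (*-assoc 2 2 (cost q n c x)))

module RationalArithmetic where
  open import Data.Maybe.Base using (Maybe; just; nothing)
  open import Data.List using (_∷_; [])
  open import Level using (0ℓ)
  -- The literal instances below carry the constraint ⊤, which instance search solves only with ⊤ in scope.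
  open import Data.Unit.Base using (⊤)
  open import Relation.Nullary using (Dec; yes; no; contradiction)
  open import Relation.Nullary.Decidable using (from-yes)
  open import Relation.Binary.PropositionalEquality
  open import Tactic.RingSolver using (solve)
  open import Tactic.RingSolver.Core.AlmostCommutativeRing using (AlmostCommutativeRing; fromCommutativeRing)
  open import Agda.Builtin.FromNat using (Number; fromNat)
  open import Data.Nat.Base as ℕ using (ℕ; zero; suc)
  import Data.Nat.Properties as ℕ
  import Data.Nat.Literals as ℕ
  open import Data.Integer.Base as ℤ using (+[1+_])
  open import Data.Integer.Tactic.RingSolver using () renaming (solve-∀ to ℤ-solve-∀)
  open import Data.Rational
  import Data.Rational.Literals as ℚ
  open import Data.Rational.Properties
  import Data.Rational.Unnormalised.Base as ℚᵘ
  import Data.Rational.Unnormalised.Properties as ℚᵘ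

  instance
    ℕ-number : Number ℕ
    ℕ-number = ℕ.number
    ℚ-number : Number ℚ
    ℚ-number = ℚ.number

  ℚ-ring : AlmostCommutativeRing 0ℓ 0ℓ
  ℚ-ring = fromCommutativeRing +-*-commutativeRing (λ p → zero? (0ℚ ≟ p))
    where
    zero? : ∀ {p} → Dec (0ℚ ≡ p) → Maybe (0ℚ ≡ p)
    zero? (yes 0≡p) = just 0≡p
    zero? (no _)    = nothing

  0≤* : ∀ {p q} → 0ℚ ≤ p → 0ℚ ≤ q → 0ℚ ≤ p * q
  0≤* {p} {q} 0≤p 0≤q = nonNegative⁻¹ _ {{nonNeg*nonNeg⇒nonNeg p {{nonNegative 0≤p}} q {{nonNegative 0≤q}}}}

  0≤+ : ∀ {p q} → 0ℚ ≤ p → 0ℚ ≤ q → 0ℚ ≤ p + q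
  0≤+ {p} {q} 0≤p 0≤q = nonNegative⁻¹ _ {{nonNeg+nonNeg⇒nonNeg p {{nonNegative 0≤p}} q {{nonNegative 0≤q}}}}

  *-monoˡ-≤-0≤ : ∀ {r p q} → 0ℚ ≤ r → p ≤ q → r * p ≤ r * q
  *-monoˡ-≤-0≤ {r} 0≤r = *-monoˡ-≤-nonNeg r {{nonNegative 0≤r}}

  *-monoʳ-≤-0≤ : ∀ {r p q} → 0ℚ ≤ r → p ≤ q → p * r ≤ q * r
  *-monoʳ-≤-0≤ {r} 0≤r = *-monoʳ-≤-nonNeg r {{nonNegative 0≤r}}

  *-mono-≤-0≤ : ∀ {p q r s} → 0ℚ ≤ p → 0ℚ ≤ r → p ≤ q → r ≤ s → p * r ≤ q * s
  *-mono-≤-0≤ {p} {q} {r} {s} 0≤p 0≤r p≤q r≤s = begin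
    p * r   ≤⟨ *-monoʳ-≤-0≤ 0≤r p≤q ⟩
    q * r   ≤⟨ *-monoˡ-≤-0≤ (≤-trans 0≤p p≤q) r≤s ⟩
    q * s   ∎
    where open ≤-Reasoning

  *-cancelˡ-≤-0< : ∀ {r p q} → 0ℚ < r → r * p ≤ r * q → p ≤ q
  *-cancelˡ-≤-0< {r} 0<r = *-cancelˡ-≤-pos r {{positive 0<r}}

  ≤-+-0≤ : ∀ {p d} → 0ℚ ≤ d → p ≤ p + d
  ≤-+-0≤ {p} {d} 0≤d = begin
    p       ≡⟨ solve (p ∷ []) ℚ-ring ⟩
    p + 0ℚ  ≤⟨ +-monoʳ-≤ p 0≤d ⟩
    p + d   ∎
    where open ≤-Reasoning

  ≤⇒0≤- : ∀ {p q} → p ≤ q → 0ℚ ≤ q - p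
  ≤⇒0≤- {p} {q} p≤q = begin
    0ℚ      ≡⟨ solve (p ∷ []) ℚ-ring ⟩
    p - p   ≤⟨ +-monoˡ-≤ (- p) p≤q ⟩
    q - p   ∎
    where open ≤-Reasoning

  0≤-⇒≤ : ∀ {p q} → 0ℚ ≤ q - p → p ≤ q
  0≤-⇒≤ {p} {q} 0≤q-p = begin
    p             ≤⟨ ≤-+-0≤ 0≤q-p ⟩
    p + (q - p)   ≡⟨ solve (p ∷ q ∷ []) ℚ-ring ⟩
    q             ∎
    where open ≤-Reasoning

  0≤-by-positive-factor : ∀ {t x y} → 0ℚ < t → t * x ≡ y → 0ℚ ≤ y → 0ℚ ≤ x
  0≤-by-positive-factor {t} {x} {y} 0<t tx≡y 0≤y = *-cancelˡ-≤-0< 0<t (begin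
    t * 0ℚ   ≡⟨ solve (t ∷ []) ℚ-ring ⟩
    0ℚ       ≤⟨ 0≤y ⟩
    y        ≡⟨ tx≡y ⟨
    t * x    ∎)
    where open ≤-Reasoning

  <⇒0<- : ∀ {p q} → p < q → 0ℚ < q - p
  <⇒0<- {p} {q} p<q = begin-strict
    0ℚ      ≡⟨ solve (p ∷ []) ℚ-ring ⟩
    p - p   <⟨ +-monoˡ-< (- p) p<q ⟩
    q - p   ∎
    where open ≤-Reasoning

  0<* : ∀ {p q} → 0ℚ < p → 0ℚ < q → 0ℚ < p * q
  0<* {p} {q} 0<p 0<q = positive⁻¹ _ {{pos*pos⇒pos p {{positive 0<p}} q {{positive 0<q}}}}

  ε<½⇒0<1-2ε : ∀ {ε} → ε < ½ → 0ℚ < 1 - 2 * ε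
  ε<½⇒0<1-2ε {ε} ε<½ = begin-strict
    0ℚ            <⟨ 0<* (positive⁻¹ 2) (<⇒0<- ε<½) ⟩
    2 * (½ - ε)   ≡⟨ solve (ε ∷ []) ℚ-ring ⟩
    1 - 2 * ε     ∎
    where open ≤-Reasoning

  module _ {ε ν : ℚ} (0≤ε : 0ℚ ≤ ε) (ε<½ : ε < ½) (ν-spec : ν * (1 - 2 * ε) ≡ 2) where

    0<1-2ε : 0ℚ < 1 - 2 * ε
    0<1-2ε = ε<½⇒0<1-2ε ε<½

    0≤ν : 0ℚ ≤ ν
    0≤ν = 0≤-by-positive-factor 0<1-2ε (trans (*-comm (1 - 2 * ε) ν) ν-spec) (nonNegative⁻¹ 2)

    1≤4ε⇒1≤εν : 1 ≤ 4 * ε → 1 ≤ ε * ν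
    1≤4ε⇒1≤εν 1≤4ε = 0≤-⇒≤ (0≤-by-positive-factor 0<1-2ε (begin-equality
      (1 - 2 * ε) * (ε * ν - 1)    ≡⟨ solve (ε ∷ ν ∷ []) ℚ-ring ⟩
      ε * (ν * (1 - 2 * ε)) - (1 - 2 * ε) ≡⟨ cong (λ s → ε * s - (1 - 2 * ε)) ν-spec ⟩
      ε * 2 - (1 - 2 * ε)          ≡⟨ solve (ε ∷ []) ℚ-ring ⟩
      4 * ε - 1                    ∎) (≤⇒0≤- 1≤4ε))
      where open ≤-Reasoning

    1≤4ε⇒1≤coefficient : 1 ≤ 4 * ε → 1 ≤ ε + 2 * ε * ε * ν * (2 + ν)
    1≤4ε⇒1≤coefficient 1≤4ε = begin
      1                                                      ≤⟨ ≤-+-0≤ 0≤slack ⟩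
      1 + (ε + 4 * ε * (ε * ν) + 2 * ((ε * ν - 1) * (ε * ν - 1)) + 4 * (ε * ν - 1) + 1)
                                                             ≡⟨ solve (ε ∷ ν ∷ []) ℚ-ring ⟩
      ε + 2 * ε * ε * ν * (2 + ν)                            ∎
      where
      open ≤-Reasoning
      0≤w : 0ℚ ≤ ε * ν - 1
      0≤w = ≤⇒0≤- (1≤4ε⇒1≤εν 1≤4ε)
      slack = ε + 4 * ε * (ε * ν) + 2 * ((ε * ν - 1) * (ε * ν - 1)) + 4 * (ε * ν - 1) + 1
      0≤slack : 0ℚ ≤ slack
      0≤slack = 0≤+ (0≤+ (0≤+ (0≤+ 0≤ε (0≤* (0≤* (nonNegative⁻¹ 4) 0≤ε) (0≤* 0≤ε 0≤ν)))
                                   (0≤* (nonNegative⁻¹ 2) (0≤* 0≤w 0≤w)))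
                              (0≤* (nonNegative⁻¹ 4) 0≤w))
                         (nonNegative⁻¹ 1)

    4ε<1⇒ν≤4 : 4 * ε < 1 → ν ≤ 4
    4ε<1⇒ν≤4 4ε<1 = 0≤-⇒≤ (0≤-by-positive-factor 0<1-2ε (begin-equality
      (1 - 2 * ε) * (4 - ν)               ≡⟨ solve (ε ∷ ν ∷ []) ℚ-ring ⟩
      4 * (1 - 2 * ε) - ν * (1 - 2 * ε)   ≡⟨ cong (λ s → 4 * (1 - 2 * ε) - s) ν-spec ⟩
      4 * (1 - 2 * ε) - 2                 ≡⟨ solve (ε ∷ []) ℚ-ring ⟩
      2 * (1 - 4 * ε)                     ∎) (0≤* (nonNegative⁻¹ 2) (≤⇒0≤- (<⇒≤ 4ε<1))))
      where open ≤-Reasoning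

    4ε<1⇒εν≤1 : 4 * ε < 1 → ε * ν ≤ 1
    4ε<1⇒εν≤1 4ε<1 = 0≤-⇒≤ (0≤-by-positive-factor 0<1-2ε (begin-equality
      (1 - 2 * ε) * (1 - ε * ν)           ≡⟨ solve (ε ∷ ν ∷ []) ℚ-ring ⟩
      (1 - 2 * ε) - ε * (ν * (1 - 2 * ε)) ≡⟨ cong (λ s → (1 - 2 * ε) - ε * s) ν-spec ⟩
      (1 - 2 * ε) - ε * 2                 ≡⟨ solve (ε ∷ []) ℚ-ring ⟩
      1 - 4 * ε                           ∎) (≤⇒0≤- (<⇒≤ 4ε<1)))
      where open ≤-Reasoning

    module _ {n : ℚ} (9≤n : 9 ≤ n) where

      0<n : 0ℚ < n
      0<n = <-≤-trans (from-yes (0ℚ <? 9)) 9≤n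

      0≤n-1 : 0ℚ ≤ n - 1
      0≤n-1 = ≤⇒0≤- (≤-trans (from-yes (1 ≤? 9)) 9≤n)

      0≤M : 0ℚ ≤ n * (n - 1) * ½
      0≤M = 0≤* (0≤* (<⇒≤ 0<n) 0≤n-1) (nonNegative⁻¹ ½)

      misvoted-bound : ∀ {K a} → 4 * ε < 1 → 0ℚ ≤ K → a ≤ ε * (n - 1) →
                       K * n ≤ 2 * ε * (n * (n - 1)) + K * (2 * a + 2) → K ≤ ε * ν * (n - 1) + 4
      -- Multiply K·n ≤ 2εn(n − 1) + K(2ε(n − 1) + 2) by ν/2 and use ν(1 − 2ε) = 2.
      misvoted-bound {K} {a} 4ε<1 0≤K a≤ Kn≤ = *-cancelˡ-≤-0< 0<n-3 (begin
        (n - 3) * K                                ≤⟨ *-monoʳ-≤-0≤ 0≤K n-3≤ ⟩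
        ((n - 1) - ν * ½) * K                      ≡⟨ solve (n ∷ ν ∷ K ∷ []) ℚ-ring ⟩
        (2 * (n - 1) * ½ - ν * ½) * K              ≡⟨ cong (λ s → (s * (n - 1) * ½ - ν * ½) * K) ν-spec ⟨
        (ν * (1 - 2 * ε) * (n - 1) * ½ - ν * ½) * K
                                                   ≡⟨ solve (n ∷ ε ∷ ν ∷ K ∷ []) ℚ-ring ⟩
        ν * ½ * (K * n) - K * (ε * ν * (n - 1) + ν)
                                                   ≤⟨ +-monoˡ-≤ (- (K * (ε * ν * (n - 1) + ν)))
                                                                (*-monoˡ-≤-0≤ (0≤* 0≤ν (nonNegative⁻¹ ½)) Kn≤′) ⟩
        ν * ½ * (2 * ε * (n * (n - 1)) + K * (2 * (ε * (n - 1)) + 2)) - K * (ε * ν * (n - 1) + ν)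
                                                   ≡⟨ solve (n ∷ ε ∷ ν ∷ K ∷ []) ℚ-ring ⟩
        ε * ν * (n * (n - 1))                      ≤⟨ ≤-+-0≤ slack ⟩
        ε * ν * (n * (n - 1)) + (3 * (1 - ε * ν) * (n - 1) + (n - 9))
                                                   ≡⟨ solve (n ∷ ε ∷ ν ∷ []) ℚ-ring ⟩
        (n - 3) * (ε * ν * (n - 1) + 4)            ∎)
        where
        open ≤-Reasoning
        0<n-3 : 0ℚ < n - 3
        0<n-3 = begin-strict
          0ℚ            <⟨ positive⁻¹ 6 ⟩
          6             ≤⟨ ≤-+-0≤ (≤⇒0≤- 9≤n) ⟩
          6 + (n - 9)   ≡⟨ solve (n ∷ []) ℚ-ring ⟩
          n - 3         ∎
        n-3≤ : n - 3 ≤ (n - 1) - ν * ½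
        n-3≤ = begin
          n - 3                   ≤⟨ ≤-+-0≤ (0≤* (≤⇒0≤- (4ε<1⇒ν≤4 4ε<1)) (nonNegative⁻¹ ½)) ⟩
          n - 3 + (4 - ν) * ½     ≡⟨ solve (n ∷ ν ∷ []) ℚ-ring ⟩
          (n - 1) - ν * ½         ∎
        Kn≤′ : K * n ≤ 2 * ε * (n * (n - 1)) + K * (2 * (ε * (n - 1)) + 2)
        Kn≤′ = ≤-trans Kn≤ (+-monoʳ-≤ (2 * ε * (n * (n - 1)))
                 (*-monoˡ-≤-0≤ 0≤K (+-monoˡ-≤ 2 (*-monoˡ-≤-0≤ (nonNegative⁻¹ 2) a≤))))
        slack : 0ℚ ≤ 3 * (1 - ε * ν) * (n - 1) + (n - 9)
        slack = 0≤+ (0≤* (0≤* (nonNegative⁻¹ 3) (≤⇒0≤- (4ε<1⇒εν≤1 4ε<1))) 0≤n-1) (≤⇒0≤- 9≤n)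

      -- The overhead K² + K(2a + 2) at the extreme values K = εν(n − 1) + 4 and a = ε(n − 1).
      overhead-bound : ∀ {δ} → 4 * ε < 1 → 84 ≤ δ * n →
                       (ε * ν * (n - 1) + 4) * (ε * ν * (n - 1) + 4) + (ε * ν * (n - 1) + 4) * (2 * (ε * (n - 1)) + 2)
                       ≤ (2 * ε * ε * ν * (2 + ν) + δ) * (n * (n - 1) * ½)
      overhead-bound {δ} 4ε<1 84≤δn = begin
        (ε * ν * (n - 1) + 4) * (ε * ν * (n - 1) + 4) + (ε * ν * (n - 1) + 4) * (2 * (ε * (n - 1)) + 2)
          ≤⟨ ≤-+-0≤ 0≤slack ⟩
        (ε * ν * (n - 1) + 4) * (ε * ν * (n - 1) + 4) + (ε * ν * (n - 1) + 4) * (2 * (ε * (n - 1)) + 2)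
          + (ε * ε * ν * (2 + ν) * (n - 1) + (δ * n - 84) * (n - 1) * ½
             + 10 * (1 - ε * ν) * (n - 1) + 2 * (1 - 4 * ε) * (n - 1) + 6 * (n - 1) + 24 * (n - 2))
          ≡⟨ solve (n ∷ ε ∷ ν ∷ δ ∷ []) ℚ-ring ⟩
        (2 * ε * ε * ν * (2 + ν) + δ) * (n * (n - 1) * ½) ∎
        where
        open ≤-Reasoning
        0≤slack : 0ℚ ≤ ε * ε * ν * (2 + ν) * (n - 1) + (δ * n - 84) * (n - 1) * ½
                       + 10 * (1 - ε * ν) * (n - 1) + 2 * (1 - 4 * ε) * (n - 1) + 6 * (n - 1) + 24 * (n - 2)
        0≤slack =
          0≤+ (0≤+ (0≤+ (0≤+ (0≤+
            (0≤* (0≤* (0≤* (0≤* 0≤ε 0≤ε) 0≤ν) (0≤+ (nonNegative⁻¹ 2) 0≤ν)) 0≤n-1)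
            (0≤* (0≤* (≤⇒0≤- 84≤δn) 0≤n-1) (nonNegative⁻¹ ½)))
            (0≤* (0≤* (nonNegative⁻¹ 10) (≤⇒0≤- (4ε<1⇒εν≤1 4ε<1))) 0≤n-1))
            (0≤* (0≤* (nonNegative⁻¹ 2) (≤⇒0≤- (<⇒≤ 4ε<1))) 0≤n-1))
            (0≤* (nonNegative⁻¹ 6) 0≤n-1))
            (0≤* (nonNegative⁻¹ 24) (≤⇒0≤- (≤-trans (from-yes (2 ≤? 9)) 9≤n)))

      voting-bound : ∀ {K a C O δ} → 2 * O ≡ ε * (n * (n - 1)) → 0ℚ ≤ δ → 84 ≤ δ * n →
                     0ℚ ≤ K → 0ℚ ≤ a →
                     n * a ≤ 2 * O →
                     K * n ≤ 4 * O + K * (2 * a + 2) →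
                     C ≤ O + K * K + K * (2 * a + 2) →
                     2 * C ≤ n * (n - 1) →
                     C ≤ (ε + 2 * ε * ε * ν * (2 + ν) + δ) * (n * (n - 1) * ½)
      -- For 4ε ≥ 1 the coefficient is at least 1, so C ≤ m already suffices.
      voting-bound {K} {a} {C} {O} {δ} 2O≡ 0≤δ 84≤δn 0≤K 0≤a na≤ Kn≤ C≤ 2C≤ with 4 * ε <? 1
      ... | no 4ε≮1 = begin
        C                                                    ≡⟨ solve (C ∷ []) ℚ-ring ⟩
        2 * C * ½                                            ≤⟨ *-monoʳ-≤-0≤ (nonNegative⁻¹ ½) 2C≤ ⟩
        n * (n - 1) * ½                                      ≡⟨ *-identityˡ (n * (n - 1) * ½) ⟨
        1 * (n * (n - 1) * ½)                                ≤⟨ *-monoʳ-≤-0≤ 0≤M 1≤coefficient+δ ⟩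
        (ε + 2 * ε * ε * ν * (2 + ν) + δ) * (n * (n - 1) * ½) ∎
        where
        open ≤-Reasoning
        1≤coefficient+δ : 1 ≤ ε + 2 * ε * ε * ν * (2 + ν) + δ
        1≤coefficient+δ = ≤-trans (1≤4ε⇒1≤coefficient (≮⇒≥ 4ε≮1)) (≤-+-0≤ 0≤δ)
      ... | yes 4ε<1 = begin
        C                                                             ≤⟨ C≤ ⟩
        O + K * K + K * (2 * a + 2)                                   ≡⟨ cong (λ t → t + K * K + K * (2 * a + 2)) O≡ ⟩
        ε * (n * (n - 1)) * ½ + K * K + K * (2 * a + 2)
          ≤⟨ +-mono-≤ (+-monoʳ-≤ (ε * (n * (n - 1)) * ½) (*-mono-≤-0≤ 0≤K 0≤K K≤κ K≤κ))
                      (*-mono-≤-0≤ 0≤K 0≤2a+2 K≤κ (+-monoˡ-≤ 2 (*-monoˡ-≤-0≤ (nonNegative⁻¹ 2) a≤))) ⟩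
        ε * (n * (n - 1)) * ½ + κ * κ + κ * (2 * (ε * (n - 1)) + 2)
          ≡⟨ +-assoc (ε * (n * (n - 1)) * ½) (κ * κ) _ ⟩
        ε * (n * (n - 1)) * ½ + (κ * κ + κ * (2 * (ε * (n - 1)) + 2))
          ≤⟨ +-monoʳ-≤ (ε * (n * (n - 1)) * ½) (overhead-bound 4ε<1 84≤δn) ⟩
        ε * (n * (n - 1)) * ½ + (2 * ε * ε * ν * (2 + ν) + δ) * (n * (n - 1) * ½)
          ≡⟨ solve (n ∷ ε ∷ ν ∷ δ ∷ []) ℚ-ring ⟩
        (ε + 2 * ε * ε * ν * (2 + ν) + δ) * (n * (n - 1) * ½) ∎
        where
        open ≤-Reasoning
        κ = ε * ν * (n - 1) + 4
        a≤ : a ≤ ε * (n - 1)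
        a≤ = *-cancelˡ-≤-0< 0<n (begin
          n * a                  ≤⟨ na≤ ⟩
          2 * O                  ≡⟨ 2O≡ ⟩
          ε * (n * (n - 1))      ≡⟨ solve (n ∷ ε ∷ []) ℚ-ring ⟩
          n * (ε * (n - 1))      ∎)
        O≡ : O ≡ ε * (n * (n - 1)) * ½
        O≡ = begin-equality
          O                      ≡⟨ solve (O ∷ []) ℚ-ring ⟩
          2 * O * ½              ≡⟨ cong (_* ½) 2O≡ ⟩
          ε * (n * (n - 1)) * ½  ∎
        4O≡ : 4 * O ≡ 2 * ε * (n * (n - 1))
        4O≡ = begin-equality
          4 * O                  ≡⟨ solve (O ∷ []) ℚ-ring ⟩
          2 * (2 * O)            ≡⟨ cong (2 *_) 2O≡ ⟩
          2 * (ε * (n * (n - 1))) ≡⟨ solve (n ∷ ε ∷ []) ℚ-ring ⟩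
          2 * ε * (n * (n - 1))  ∎
        K≤κ : K ≤ κ
        K≤κ = misvoted-bound 4ε<1 0≤K a≤ (≤-trans Kn≤ (≤-reflexive (cong (_+ K * (2 * a + 2)) 4O≡)))
        0≤2a+2 : 0ℚ ≤ 2 * a + 2
        0≤2a+2 = 0≤+ (0≤* (nonNegative⁻¹ 2) 0≤a) (nonNegative⁻¹ 2)

  ι : ℕ → ℚ
  ι a = ℚ.fromℤ (ℤ.+ a)

  /1≡ι : ∀ a → ℤ.+ a / 1 ≡ ι a
  /1≡ι a = fromℚᵘ-toℚᵘ (ι a)

  ι-suc : ∀ a → ι (suc a) ≡ 1 + ι a
  ι-suc a = toℚᵘ-injective (ℚᵘ.≃-sym (ℚᵘ.≃-trans (toℚᵘ-homo-+ 1 (ι a)) (ℚᵘ.*≡* (identity (ℤ.+ a)))))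
    where
    identity : ∀ x → (ℤ.+ 1 ℤ.* ℤ.+ 1 ℤ.+ x ℤ.* ℤ.+ 1) ℤ.* ℤ.+ 1 ≡ (ℤ.+ 1 ℤ.+ x) ℤ.* (ℤ.+ 1 ℤ.* ℤ.+ 1)
    identity = ℤ-solve-∀

  ι-+ : ∀ a b → ι (a ℕ.+ b) ≡ ι a + ι b
  ι-+ zero    b = sym (+-identityˡ (ι b))
  ι-+ (suc a) b = begin
    ι (suc (a ℕ.+ b))     ≡⟨ ι-suc (a ℕ.+ b) ⟩
    1 + ι (a ℕ.+ b)       ≡⟨ cong (1 +_) (ι-+ a b) ⟩
    1 + (ι a + ι b)       ≡⟨ +-assoc 1 (ι a) (ι b) ⟨
    1 + ι a + ι b         ≡⟨ cong (_+ ι b) (ι-suc a) ⟨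
    ι (suc a) + ι b       ∎
    where open ≡-Reasoning

  ι-* : ∀ a b → ι (a ℕ.* b) ≡ ι a * ι b
  ι-* zero    b = sym (*-zeroˡ (ι b))
  ι-* (suc a) b = begin
    ι (b ℕ.+ a ℕ.* b)     ≡⟨ ι-+ b (a ℕ.* b) ⟩
    ι b + ι (a ℕ.* b)     ≡⟨ cong (ι b +_) (ι-* a b) ⟩
    ι b + ι a * ι b       ≡⟨ distrib (ι a) (ι b) ⟩
    (1 + ι a) * ι b       ≡⟨ cong (_* ι b) (ι-suc a) ⟨
    ι (suc a) * ι b       ∎
    where
    open ≡-Reasoning
    distrib : ∀ x y → y + x * y ≡ (1 + x) * y
    distrib x y = solve (x ∷ y ∷ []) ℚ-ring

  ι-pred : ∀ m → ι m ≡ ι (suc m) - 1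
  ι-pred m = begin
    ι m                 ≡⟨ cancel (ι m) ⟩
    1 + ι m - 1         ≡⟨ cong (_- 1) (ι-suc m) ⟨
    ι (suc m) - 1       ∎
    where
    open ≡-Reasoning
    cancel : ∀ x → x ≡ 1 + x - 1
    cancel x = solve (x ∷ []) ℚ-ring

  0≤ι : ∀ a → 0ℚ ≤ ι a
  0≤ι a = nonNegative⁻¹ (ι a)

  ι-mono : ∀ {a b} → a ℕ.≤ b → ι a ≤ ι b
  ι-mono {a} {b} a≤b = begin
    ι a                 ≤⟨ ≤-+-0≤ (0≤ι (b ℕ.∸ a)) ⟩
    ι a + ι (b ℕ.∸ a)   ≡⟨ ι-+ a (b ℕ.∸ a) ⟨
    ι (a ℕ.+ (b ℕ.∸ a)) ≡⟨ cong ι (ℕ.m+[n∸m]≡n a≤b) ⟩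
    ι b                 ∎
    where open ≤-Reasoning

  /-*-denominator : ∀ m k → (ℤ.+ m / suc k) * ι (suc k) ≡ ι m
  /-*-denominator m k = toℚᵘ-injective (ℚᵘ.≃-trans (toℚᵘ-homo-* (ℤ.+ m / suc k) (ι (suc k)))
    (ℚᵘ.≃-trans (ℚᵘ.*-congʳ (toℚᵘ-fromℚᵘ (ℚᵘ.mkℚᵘ (ℤ.+ m) k))) (ℚᵘ.*≡* (identity (ℤ.+ m) +[1+ k ]))))
    where
    identity : ∀ x y → (x ℤ.* y) ℤ.* ℤ.+ 1 ≡ x ℤ.* (y ℤ.* ℤ.+ 1)
    identity = ℤ-solve-∀

  /2≡*½ : ∀ k → ℤ.+ k / 2 ≡ ι k * ½
  /2≡*½ k = begin-equality
    ℤ.+ k / 2                 ≡⟨ double-half (ℤ.+ k / 2) ⟩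
    (ℤ.+ k / 2) * ι 2 * ½     ≡⟨ cong (_* ½) (/-*-denominator k 1) ⟩
    ι k * ½                   ∎
    where
    open ≤-Reasoning
    double-half : ∀ x → x ≡ x * 2 * ½
    double-half x = solve (x ∷ []) ℚ-ring

  1≤δ*denominator : ∀ δ → 0ℚ < δ → 1 ≤ δ * ι (↧ₙ δ)
  1≤δ*denominator δ@(mkℚ +[1+ k ] d _) _ = begin
    1                                  ≤⟨ ι-mono (ℕ.s≤s ℕ.z≤n) ⟩
    ι (suc k)                          ≡⟨ /-*-denominator (suc k) d ⟨
    (ℤ.+ suc k / suc d) * ι (suc d)    ≡⟨ cong (_* ι (suc d)) (↥p/↧p≡p δ) ⟩
    δ * ι (suc d)                      ∎
    where open ≤-Reasoning
  1≤δ*denominator (mkℚ (ℤ.+ 0)    _ _) 0<δ with () ← positive 0<δ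
  1≤δ*denominator (mkℚ ℤ.-[1+ _ ] _ _) 0<δ with () ← positive 0<δ

  inv-inverse : ∀ t → 0ℚ < t → inv t * t ≡ 1
  inv-inverse t 0<t with t ≟ 0ℚ
  ... | yes t≡0 = contradiction (sym t≡0) (<⇒≢ 0<t)
  ... | no t≢0  = *-inverseˡ t {{≢-nonZero t≢0}}

  nu-spec : ∀ {ε} → ε < ½ → nu ε * (1 - 2 * ε) ≡ 2
  nu-spec {ε} ε<½ = begin-equality
    2 * inv (1 - 2 * ε) * (1 - 2 * ε)     ≡⟨ *-assoc 2 (inv (1 - 2 * ε)) (1 - 2 * ε) ⟩
    2 * (inv (1 - 2 * ε) * (1 - 2 * ε))   ≡⟨ cong (2 *_) (inv-inverse (1 - 2 * ε) (ε<½⇒0<1-2ε ε<½)) ⟩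
    2 * 1                                 ≡⟨ *-identityʳ 2 ⟩
    2                                     ∎
    where open ≤-Reasoning

  epsilon-clears : ∀ o n → 0 ℕ.< n ℕ.* (n ℕ.∸ 1) → epsilon o n * ι (n ℕ.* (n ℕ.∸ 1)) ≡ 2 * ι o
  epsilon-clears o n 0<T with n ℕ.* (n ℕ.∸ 1)
  epsilon-clears o n () | zero
  ... | suc k = trans (/-*-denominator (2 ℕ.* o) k) (ι-* 2 o)

  84≤δ*ι : ∀ δ {n} → 0ℚ < δ → 84 ℕ.* ↧ₙ δ ℕ.≤ n → 84 ≤ δ * ι n
  84≤δ*ι δ {n} 0<δ 84D≤n = begin
    84                       ≡⟨ *-identityʳ 84 ⟨
    84 * 1                   ≤⟨ *-monoˡ-≤-0≤ (nonNegative⁻¹ 84) (1≤δ*denominator δ 0<δ) ⟩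
    84 * (δ * ι (↧ₙ δ))      ≡⟨ swap δ (ι (↧ₙ δ)) ⟩
    δ * (84 * ι (↧ₙ δ))      ≡⟨ cong (δ *_) (ι-* 84 (↧ₙ δ)) ⟨
    δ * ι (84 ℕ.* ↧ₙ δ)      ≤⟨ *-monoˡ-≤-0≤ (<⇒≤ 0<δ) (ι-mono 84D≤n) ⟩
    δ * ι n                  ∎
    where
    open ≤-Reasoning
    swap : ∀ x y → 84 * (x * y) ≡ x * (84 * y)
    swap x y = solve (x ∷ y ∷ []) ℚ-ring

  ι-2a+2 : ∀ a → ι (2 ℕ.* a ℕ.+ 2) ≡ 2 * ι a + 2
  ι-2a+2 a = trans (ι-+ (2 ℕ.* a) 2) (cong (_+ 2) (ι-* 2 a))

  voting-bound-ℕ : ∀ {m K a C opt δ} → 0ℚ < δ → 9 ℕ.+ 84 ℕ.* ↧ₙ δ ℕ.≤ suc m →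
    epsilon opt (suc m) < ½ →
    suc m ℕ.* a ℕ.≤ 2 ℕ.* opt →
    K ℕ.* suc m ℕ.≤ 4 ℕ.* opt ℕ.+ K ℕ.* (2 ℕ.* a ℕ.+ 2) →
    C ℕ.≤ opt ℕ.+ K ℕ.* K ℕ.+ K ℕ.* (2 ℕ.* a ℕ.+ 2) →
    2 ℕ.* C ℕ.≤ suc m ℕ.* m →
    ι C ≤ (epsilon opt (suc m) + 2 * epsilon opt (suc m) * epsilon opt (suc m) * nu (epsilon opt (suc m))
           * (2 + nu (epsilon opt (suc m))) + δ) * edgesℚ (suc m)
  voting-bound-ℕ {m} {K} {a} {C} {opt} {δ} 0<δ N≤n ε<½ na≤ Kn≤ C≤ 2C≤ =
    subst (λ M → ι C ≤ (ε + 2 * ε * ε * nu ε * (2 + nu ε) + δ) * M) (sym edges≡)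
      (voting-bound 0≤ε ε<½ (nu-spec ε<½) (ι-mono 9≤n) 2O≡ (<⇒≤ 0<δ)
        (84≤δ*ι δ 0<δ (ℕ.≤-trans (ℕ.m≤n+m _ 9) N≤n)) (0≤ι K) (0≤ι a)
        (subst₂ _≤_ (ι-* (suc m) a) (ι-* 2 opt) (ι-mono na≤))
        (subst₂ _≤_ (ι-* K (suc m)) Kn-rhs (ι-mono Kn≤))
        (subst (ι C ≤_) C-rhs (ι-mono C≤))
        (subst₂ _≤_ (ι-* 2 C) ιT (ι-mono 2C≤)))
    where
    open ≤-Reasoning
    n = suc m
    ε = epsilon opt n
    9≤n : 9 ℕ.≤ n
    9≤n = ℕ.≤-trans (ℕ.m≤m+n 9 _) N≤n
    ιT : ι (n ℕ.* m) ≡ ι n * (ι n - 1)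
    ιT = trans (ι-* n m) (cong (ι n *_) (ι-pred m))
    edges≡ : edgesℚ n ≡ ι n * (ι n - 1) * ½
    edges≡ = trans (/2≡*½ (n ℕ.* m)) (cong (_* ½) ιT)
    0<T : 0 ℕ.< n ℕ.* m
    0<T = ℕ.*-mono-≤ (ℕ.≤-trans (from-yes (1 ℕ.≤? 9)) 9≤n) (ℕ.≤-pred (ℕ.≤-trans (from-yes (2 ℕ.≤? 9)) 9≤n))
    εT≡ : ε * ι (n ℕ.* m) ≡ 2 * ι opt
    εT≡ = epsilon-clears opt n 0<T
    2O≡ : 2 * ι opt ≡ ε * (ι n * (ι n - 1))
    2O≡ = trans (sym εT≡) (cong (ε *_) ιT)
    0≤ε : 0ℚ ≤ ε
    0≤ε = 0≤-by-positive-factor (<-≤-trans (positive⁻¹ 1) (ι-mono 0<T)) (trans (*-comm (ι (n ℕ.* m)) ε) εT≡)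
                                (0≤* (nonNegative⁻¹ 2) (0≤ι opt))
    Kn-rhs : ι (4 ℕ.* opt ℕ.+ K ℕ.* (2 ℕ.* a ℕ.+ 2)) ≡ 4 * ι opt + ι K * (2 * ι a + 2)
    Kn-rhs = trans (ι-+ (4 ℕ.* opt) _) (cong₂ _+_ (ι-* 4 opt) (trans (ι-* K _) (cong (ι K *_) (ι-2a+2 a))))
    C-rhs : ι (opt ℕ.+ K ℕ.* K ℕ.+ K ℕ.* (2 ℕ.* a ℕ.+ 2)) ≡ ι opt + ι K * ι K + ι K * (2 * ι a + 2)
    C-rhs = trans (ι-+ (opt ℕ.+ K ℕ.* K) _)
                  (cong₂ _+_ (trans (ι-+ opt (K ℕ.* K)) (cong (ι opt +_) (ι-* K K)))
                             (trans (ι-* K _) (cong (ι K *_) (ι-2a+2 a))))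

open import Data.Nat as ℕ using (ℕ; NonZero)
open import Data.Fin using (Fin)
open import Data.Integer using (+_)
open import Data.Rational as ℚ using (ℚ; _/_; ½)
open import Data.Product using (Σ; _×_; _,_)
open import Relation.Binary.PropositionalEquality using (subst; sym)
open VotingAlgorithm using (module Instance)
open RationalArithmetic using (/1≡ι; voting-bound-ℕ)

lemma1 : (q : ℕ) .{{_ : NonZero q}} → (δ : ℚ) → ℚ.0ℚ ℚ.< δ →
    Σ ℕ λ N → ∀ n → N ℕ.≤ n →
    (c : Fin n → Fin n → Fin q) → ValidInstance q n c →
    (opt : ℕ) → IsOpt q n c opt →
    epsilon opt n ℚ.< ½ →
    (final : Fin n → Fin n → Fin q) → (∀ p → IsVotingOutput q n c p (final p)) →
    (p* : Fin n) → (∀ p → cost q n c (final p*) ℕ.≤ cost q n c (final p)) →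
    (+ cost q n c (final p*)) / 1
      ℚ.≤ (epsilon opt n
           ℚ.+ (+ 2 / 1) ℚ.* epsilon opt n ℚ.* epsilon opt n ℚ.* nu (epsilon opt n)
               ℚ.* ((+ 2 / 1) ℚ.+ nu (epsilon opt n))
           ℚ.+ δ) ℚ.* edgesℚ n
lemma1 q δ 0<δ = 9 ℕ.+ 84 ℕ.* ℚ.↧ₙ δ , λ where
  ℕ.zero ()
  (ℕ.suc m) N≤n c valid opt ((x , cost-x) , _) ε<½ final voting p* p*-best →
    let open Instance q (ℕ.suc m) c valid
        (K , a , n*a≤ , K*n≤ , C≤) = best-output-bound x cost-x final voting p* p*-best
    in subst (ℚ._≤ _) (sym (/1≡ι (cost q (ℕ.suc m) c (final p*))))
         (voting-bound-ℕ {K = K} {a = a} 0<δ N≤n ε<½ n*a≤ K*n≤ C≤ (2*cost≤n*pred[n] (final p*)))
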